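{- Let $G$ be a simple undirected graph with at least one edge and let $\operatorname{OTI}(G)$ be the set of integers in $[m,M]$. Then $m\le \operatorname{th}(G)$ and $\alpha(G)+1\le M$.
   Context: $\alpha(G)$ is the independence number of $G$. Zero forcing on an undirected graph: vertices are blue or white; a blue vertex $u$ with exactly one white neighbor $w$ may force $w$ ($u\to w$). On a digraph the same rule applies with out-neighbors in place of neighbors. A set $\mathcal F$ of forces is a set of forces of $B\subseteq V$ if, starting with exactly $B$ blue, the forces in $\mathcal F$ can be validly performed in some order after which no further force is possible. Put $\mathcal F^{[0]}=B$ and $\mathcal F^{[t+1]}=\mathcal F^{[t]}\cup\{w\notin\mathcal F^{[t]}:(u\to w)\in\mathcal F,\ u\in\mathcal F^{[t]},\ w$ the only (out-)neighbor of $u$ outside $\mathcal F^{[t]}\}$; $\operatorname{pt}(\cdot;\mathcal F)$ is the least $t$ with $\mathcal F^{[t]}=V$ ($\infty$ if none); $\operatorname{pt}(\cdot;B)=\min_{\mathcal F}\operatorname{pt}(\cdot;\mathcal F)$; the throttling number is $\operatorname{th}=\min_{B\subseteq V}(|B|+\operatorname{pt}(\cdot;B))$. An orientation $\vec G$ of $G$ replaces each edge $\{u,v\}$ by exactly one of $(u,v),(v,u)$. $\operatorname{OTI}(G)$ is the set of integers in $[m,M]$ where $m$, $M$ are the minimum and maximum of $\operatorname{th}(\vec G)$ over all orientations $\vec G$ of $G$. -}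

module Defs where

open import Data.Nat using (ℕ; _+_; _≤_)
open import Data.Bool using (Bool; true; false)
open import Data.Fin using (Fin)
open import Data.Fin.Subset using (Subset; _∈_; _∉_; ∣_∣; ⁅_⁆; _∪_)
open import Data.Product using (Σ; ∃; ∃-syntax; _×_; _,_)
open import Data.Sum using (_⊎_)
open import Data.List using (List; []; _∷_)
open import Data.List.Membership.Propositional using () renaming (_∈_ to _∈ₗ_)
open import Data.List.Relation.Binary.Permutation.Propositional using (_↭_)
open import Relation.Binary.PropositionalEquality using (_≡_)
open import Relation.Nullary using (¬_)

Digraph : ℕ → Set
Digraph n = Fin n → Fin n → Bool

record Graph (n : ℕ) : Set where
  field
    adj    : Fin n → Fin n → Bool
    sym    : ∀ u v → adj u v ≡ adj v u
    irrefl : ∀ v → adj v v ≡ false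
open Graph public

-- Zero forcing on an undirected graph is zero forcing on the symmetric digraph
-- (out-neighbours = neighbours).
asDigraph : ∀ {n} → Graph n → Digraph n
asDigraph G = adj G

HasEdge : ∀ {n} → Graph n → Set
HasEdge G = ∃[ u ] ∃[ v ] adj G u v ≡ true

Orientation : ∀ {n} → Graph n → Digraph n → Set
Orientation {n} G D =
  (∀ (u v : Fin n) → adj G u v ≡ true →
     (D u v ≡ true × D v u ≡ false) ⊎ (D u v ≡ false × D v u ≡ true))
  × (∀ (u v : Fin n) → D u v ≡ true → adj G u v ≡ true)

Force : ℕ → Set
Force n = Fin n × Fin n   -- (u , w) stands for u → w

-- u → w is a valid force when S is the blue set
ValidForce : ∀ {n} → Digraph n → Subset n → Fin n → Fin n → Set
ValidForce {n} D S u w =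
  u ∈ S × w ∉ S × D u w ≡ true × (∀ (x : Fin n) → D u x ≡ true → x ∉ S → x ≡ w)

Terminal : ∀ {n} → Digraph n → Subset n → Set
Terminal {n} D S = ∀ (u w : Fin n) → ¬ ValidForce D S u w

ValidRun : ∀ {n} → Digraph n → Subset n → List (Force n) → Set
ValidRun D S [] = Terminal D S
ValidRun D S ((u , w) ∷ L) = ValidForce D S u w × ValidRun D (S ∪ ⁅ w ⁆) L

-- F is a set of forces of B: the forces of F can be performed in some order
-- (each exactly once) starting from B, after which no force is possible.
IsSetOfForces : ∀ {n} → Digraph n → Subset n → List (Force n) → Set
IsSetOfForces D B F = ∃[ L ] (L ↭ F × ValidRun D B L)

InStage : ∀ {n} → Digraph n → Subset n → List (Force n) → ℕ → Fin n → Set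
InStage D B F ℕ.zero v = v ∈ B
InStage {n} D B F (ℕ.suc t) w =
  InStage D B F t w ⊎
  (¬ InStage D B F t w ×
   ∃[ u ] ((u , w) ∈ₗ F × InStage D B F t u × D u w ≡ true ×
           (∀ (x : Fin n) → D u x ≡ true → ¬ InStage D B F t x → x ≡ w)))

AllBlueAt : ∀ {n} → Digraph n → Subset n → List (Force n) → ℕ → Set
AllBlueAt {n} D B F t = ∀ (v : Fin n) → InStage D B F t v

-- th(D) = k: k = min over B, over sets of forces F of B, and over t with F^[t] = V,
-- of |B| + t  (nested minima of th, pt(·;B), pt(·;F) unfolded).
ThIs : ∀ {n} → Digraph n → ℕ → Set
ThIs D k =
  (∃[ B ] ∃[ F ] ∃[ t ] (IsSetOfForces D B F × AllBlueAt D B F t × ∣ B ∣ + t ≡ k))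
  × (∀ B F t → IsSetOfForces D B F → AllBlueAt D B F t → k ≤ ∣ B ∣ + t)

IsMinOrientTh : ∀ {n} → Graph n → ℕ → Set
IsMinOrientTh G m =
  (∃[ D ] (Orientation G D × ThIs D m))
  × (∀ D k → Orientation G D → ThIs D k → m ≤ k)

IsMaxOrientTh : ∀ {n} → Graph n → ℕ → Set
IsMaxOrientTh G M =
  (∃[ D ] (Orientation G D × ThIs D M))
  × (∀ D k → Orientation G D → ThIs D k → k ≤ M)

IsIndependent : ∀ {n} → Graph n → Subset n → Set
IsIndependent {n} G S = ∀ (u v : Fin n) → u ∈ S → v ∈ S → adj G u v ≡ false

IndepNumber : ∀ {n} → Graph n → ℕ → Set
IndepNumber G a =
  (∃[ S ] (IsIndependent G S × ∣ S ∣ ≡ a))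
  × (∀ S → IsIndependent G S → ∣ S ∣ ≤ a)

module Submission where

-- Both halves are proved by exhibiting one orientation and bounding its
-- throttling number against a concrete throttling witness.
--  * m ≤ th(G): take an optimal forcing process (B, F, t) of G, orient every
--    edge used by a force in its forcing direction and every other edge
--    arbitrarily.  Out-neighbourhoods only shrink, so the same forces are
--    valid in the same order and reach the same stages: th(D) ≤ |B| + t.
--  * α(G) + 1 ≤ M: orient every edge away from a maximum independent set S.
--    Vertices of S have no in-arcs, so S ⊆ B for every initial set B; hence
--    |B| + t ≥ |S| + 1 when t ≥ 1, and when t = 0 the set B = V strictly
--    contains S because G has an edge.
-- The throttling number is a minimum, which exists constructively only up to
-- double negation; since inequalities on ℕ are decidable that suffices.

open import Defs
open import Data.Nat using (ℕ; _+_; _≤_; _<_; z≤n; s≤s; _≤?_)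
open import Data.Nat.Properties using (≤-trans; ≰⇒>; +-comm; m≤m+n; +-mono-≤)
open import Data.Nat.Induction using (<-wellFounded)
open import Induction.WellFounded using (Acc; acc)
open import Data.Bool using (Bool; true; false; _∧_; _∨_; not)
open import Data.Bool.Properties using () renaming (_≟_ to _≟ᵇ_)
open import Data.Fin using (Fin)
open import Data.Fin.Properties using (<-cmp; <-asym; _<?_; any?; all?) renaming (_≟_ to _≟ᶠ_)
open import Data.Fin.Subset using (Subset; ⊤; ∣_∣; ⁅_⁆; _∪_) renaming (_∈_ to _∈ₛ_; _∉_ to _∉ₛ_)
open import Data.Fin.Subset.Properties using (∈⊤; ∣⊤∣≡n; x∈⁅x⁆; x∈p∪q⁺; p⊆q⇒∣p∣≤∣q∣; p⊂q⇒∣p∣<∣q∣) renaming (_∈?_ to _∈ₛ?_)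
open import Data.Product using (∃-syntax; _×_; _,_)
open import Data.Product.Properties using (≡-dec)
open import Data.Sum using (_⊎_; inj₁; inj₂)
open import Data.List using (List; []; _∷_)
open import Data.List.Membership.Propositional using () renaming (_∈_ to _∈ₗ_)
import Data.List.Membership.DecPropositional as DecMembership
open import Data.List.Relation.Unary.Any using (here; there)
open import Data.List.Relation.Binary.Permutation.Propositional using (↭-sym; ↭-refl)
open import Data.List.Relation.Binary.Permutation.Propositional.Properties using (∈-resp-↭)
open import Relation.Binary.PropositionalEquality using (_≡_; _≢_; refl; trans; subst) renaming (sym to ≡-sym)
open import Relation.Binary.Definitions using (tri<; tri≈; tri>)
open import Relation.Nullary using (¬_; Dec; yes; no; does)
open import Relation.Nullary.Decidable using (_×-dec_; _→-dec_; ¬?; decidable-stable; dec-true; dec-false)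
open import Data.Empty using (⊥; ⊥-elim)

Achieves : ∀ {n} → Digraph n → ℕ → Set
Achieves D k = ∃[ B ] ∃[ F ] ∃[ t ] (IsSetOfForces D B F × AllBlueAt D B F t × ∣ B ∣ + t ≡ k)

¬¬-least : (P : ℕ → Set) {v : ℕ} → P v → ¬ ¬ (∃[ k ] (P k × (∀ j → P j → k ≤ j)))
¬¬-least P {v} = go v (<-wellFounded v)
  where
  go : ∀ v → Acc _<_ v → P v → ¬ ¬ (∃[ k ] (P k × (∀ j → P j → k ≤ j)))
  go v (acc smaller) pv noLeast = noLeast (v , pv , v≤)
    where
    v≤ : ∀ j → P j → v ≤ j
    v≤ j pj = decidable-stable (v ≤? j) λ v≰j → go j (smaller (≰⇒> v≰j)) pj noLeast

¬¬-th : ∀ {n} (D : Digraph n) {v : ℕ} → Achieves D v → ¬ ¬ (∃[ k ] ThIs D k)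
¬¬-th D achieved noTh = ¬¬-least (Achieves D) achieved λ (k , achieves-k , least) →
  noTh (k , achieves-k , λ B F t forces allBlue → least _ (B , F , t , forces , allBlue , refl))

min≤achieved : ∀ {n} (G : Graph n) {m v : ℕ} (D : Digraph n) → IsMinOrientTh G m →
  Orientation G D → Achieves D v → m ≤ v
min≤achieved G {m} {v} D (_ , minimal) oriented achieved@(B , F , t , forces , allBlue , refl) =
  decidable-stable (m ≤? v) λ m≰v → ¬¬-th D achieved λ (k , th@(_ , least)) →
    m≰v (≤-trans (minimal D k oriented th) (least B F t forces allBlue))

bound≤max : ∀ {n} (G : Graph n) {M b v : ℕ} (D : Digraph n) → IsMaxOrientTh G M →
  Orientation G D → Achieves D v → (∀ k → Achieves D k → b ≤ k) → b ≤ M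
bound≤max G {M} {b} D (_ , maximal) oriented achieved bounded =
  decidable-stable (b ≤? M) λ b≰M → ¬¬-th D achieved λ (k , th@(achieves-k , _)) →
    b≰M (≤-trans (bounded k achieves-k) (maximal D k oriented th))

allBlueWitness : ∀ {n} (D : Digraph n) → Achieves D n
allBlueWitness {n} D =
  ⊤ , [] , 0 , ([] , ↭-refl , λ _ _ (_ , w∉⊤ , _) → w∉⊤ ∈⊤) , (λ _ → ∈⊤) ,
  trans (+-comm ∣ ⊤ {n} ∣ 0) (∣⊤∣≡n n)

true≢false : ¬ (true ≡ false)
true≢false ()

edge⇒distinct : ∀ {n} (G : Graph n) {x y : Fin n} → adj G x y ≡ true → x ≢ y
edge⇒distinct G {x} e refl = true≢false (trans (≡-sym e) (irrefl G x))

-- The orientation of G induced by a preference relation R that never prefers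
-- both directions of an edge: an edge follows R where R has an opinion and the
-- order of Fin n otherwise.
module Preferred {n} (G : Graph n) (R : Fin n → Fin n → Bool)
  (R-asym : ∀ x y → adj G x y ≡ true → R x y ≡ true → R y x ≡ false) where

  below : Fin n → Fin n → Bool
  below x y = does (x <? y)

  oriented : Digraph n
  oriented x y = adj G x y ∧ (R x y ∨ (not (R y x) ∧ below x y))

  arcs⊆edges : ∀ u v → oriented u v ≡ true → adj G u v ≡ true
  arcs⊆edges u v arc with adj G u v
  ... | true = refl
  ... | false = arc

  follows-preference : ∀ x y → adj G x y ≡ true → R x y ≡ true → oriented x y ≡ true
  follows-preference x y e r rewrite e | r = refl

  against-preference : ∀ x y → R y x ≡ true → oriented x y ≡ false
  against-preference x y r = byEdge (adj G x y) refl
    where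
    byEdge : ∀ b → adj G x y ≡ b → oriented x y ≡ false
    byEdge false e rewrite e = refl
    byEdge true e rewrite e | R-asym y x (trans (Graph.sym G y x) e) r | r = refl

  tie-break : ∀ x y → x ≢ y →
    (below x y ≡ true × below y x ≡ false) ⊎ (below x y ≡ false × below y x ≡ true)
  tie-break x y x≢y with <-cmp x y
  ... | tri< x<y _ _ = inj₁ (dec-true (x <? y) x<y , dec-false (y <? x) (<-asym x<y))
  ... | tri≈ _ x≡y _ = ⊥-elim (x≢y x≡y)
  ... | tri> _ _ y<x = inj₂ (dec-false (x <? y) (<-asym y<x) , dec-true (y <? x) y<x)

  isOrientation : Orientation G oriented
  isOrientation = oneDirection , arcs⊆edges
    where
    oneDirection : ∀ u v → adj G u v ≡ true →
      (oriented u v ≡ true × oriented v u ≡ false) ⊎ (oriented u v ≡ false × oriented v u ≡ true)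
    oneDirection u v e = byPreference (R u v) (R v u) refl refl
      where
      e′ : adj G v u ≡ true
      e′ = trans (Graph.sym G v u) e

      byPreference : ∀ r s → R u v ≡ r → R v u ≡ s →
        (oriented u v ≡ true × oriented v u ≡ false) ⊎ (oriented u v ≡ false × oriented v u ≡ true)
      byPreference true _ ruv _ = inj₁ (follows-preference u v e ruv , against-preference v u ruv)
      byPreference false true _ rvu = inj₂ (against-preference u v rvu , follows-preference v u e′ rvu)
      byPreference false false ruv rvu
        rewrite e | e′ | ruv | rvu = tie-break u v (edge⇒distinct G e)

module Runs {n} (E : Digraph n) where

  target∉start : ∀ S L {u w} → ValidRun E S L → (u , w) ∈ₗ L → w ∉ₛ S
  target∉start S (_ ∷ L) ((_ , w∉ , _) , _) (here refl) = w∉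
  target∉start S ((_ , b) ∷ L) (_ , run) (there p) w∈ =
    target∉start (S ∪ ⁅ b ⁆) L run p (x∈p∪q⁺ (inj₁ w∈))

  force-is-arc : ∀ S L {u w} → ValidRun E S L → (u , w) ∈ₗ L → E u w ≡ true
  force-is-arc S (_ ∷ L) ((_ , _ , arc , _) , _) (here refl) = arc
  force-is-arc S ((_ , b) ∷ L) (_ , run) (there p) = force-is-arc (S ∪ ⁅ b ⁆) L run p

  -- A run never forces along an edge in both directions: the first such force
  -- makes both ends blue.
  no-opposite-forces : ∀ S L {x y} → ValidRun E S L → (x , y) ∈ₗ L → (y , x) ∈ₗ L → ⊥
  no-opposite-forces S (_ ∷ L) ((x∈ , x∉ , _) , _) (here refl) (here refl) = x∉ x∈
  no-opposite-forces S ((_ , b) ∷ L) ((x∈ , _) , run) (here refl) (there q) =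
    target∉start (S ∪ ⁅ b ⁆) L run q (x∈p∪q⁺ (inj₁ x∈))
  no-opposite-forces S ((_ , b) ∷ L) ((y∈ , _) , run) (there p) (here refl) =
    target∉start (S ∪ ⁅ b ⁆) L run p (x∈p∪q⁺ (inj₁ y∈))
  no-opposite-forces S ((_ , b) ∷ L) (_ , run) (there p) (there q) =
    no-opposite-forces (S ∪ ⁅ b ⁆) L run p q

  -- A run that turns every vertex blue stays valid in any subdigraph D of E
  -- containing its forces: deleting other arcs only removes white
  -- out-neighbours, and the final all-blue set is terminal in every digraph.
  restrict-run : (D : Digraph n) → (∀ u v → D u v ≡ true → E u v ≡ true) →
    ∀ S L → (∀ u w → (u , w) ∈ₗ L → D u w ≡ true) →
    (∀ v → v ∈ₛ S ⊎ ∃[ u ] ((u , v) ∈ₗ L)) → ValidRun E S L → ValidRun D S L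
  restrict-run D D⊆E S [] _ covered _ u w (_ , w∉ , _) with covered w
  ... | inj₁ w∈ = w∉ w∈
  ... | inj₂ (_ , ())
  restrict-run D D⊆E S ((a , b) ∷ L) forcesInD covered ((a∈ , b∉ , _ , unique) , run) =
    (a∈ , b∉ , forcesInD a b (here refl) , λ x arc x∉ → unique x (D⊆E a x arc) x∉) ,
    restrict-run D D⊆E (S ∪ ⁅ b ⁆) L (λ u w p → forcesInD u w (there p)) covered′ run
    where
    covered′ : ∀ v → v ∈ₛ (S ∪ ⁅ b ⁆) ⊎ ∃[ u ] ((u , v) ∈ₗ L)
    covered′ v with covered v
    ... | inj₁ v∈ = inj₁ (x∈p∪q⁺ (inj₁ v∈))
    ... | inj₂ (_ , here refl) = inj₁ (x∈p∪q⁺ (inj₂ (x∈⁅x⁆ v)))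
    ... | inj₂ (u , there p) = inj₂ (u , p)

_∈ₗ?_ : ∀ {n} (f : Force n) (L : List (Force n)) → Dec (f ∈ₗ L)
f ∈ₗ? L = DecMembership._∈?_ (≡-dec _≟ᶠ_ _≟ᶠ_) f L

inStage? : ∀ {n} (D : Digraph n) B F t v → Dec (InStage D B F t v)
inStage? D B F ℕ.zero v = v ∈ₛ? B
inStage? D B F (ℕ.suc t) w with inStage? D B F t w
... | yes p = yes (inj₁ p)
... | no ¬p with any? (λ u → ((u , w) ∈ₗ? F) ×-dec inStage? D B F t u ×-dec (D u w ≟ᵇ true)
                   ×-dec all? (λ x → (D u x ≟ᵇ true) →-dec (¬? (inStage? D B F t x) →-dec (x ≟ᶠ w))))
...   | yes q = yes (inj₂ (¬p , q))
...   | no ¬q = no λ { (inj₁ p) → ¬p p ; (inj₂ (_ , q)) → ¬q q }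

stage-origin : ∀ {n} (D : Digraph n) B F t v → InStage D B F t v → v ∈ₛ B ⊎ ∃[ u ] ((u , v) ∈ₗ F)
stage-origin D B F ℕ.zero v p = inj₁ p
stage-origin D B F (ℕ.suc t) v (inj₁ p) = stage-origin D B F t v p
stage-origin D B F (ℕ.suc t) v (inj₂ (_ , u , u→v , _)) = inj₂ (u , u→v)

no-in-arcs⇒initial : ∀ {n} (D : Digraph n) B F t v → (∀ u → D u v ≡ false) →
  InStage D B F t v → v ∈ₛ B
no-in-arcs⇒initial D B F ℕ.zero v _ p = p
no-in-arcs⇒initial D B F (ℕ.suc t) v source (inj₁ p) = no-in-arcs⇒initial D B F t v source p
no-in-arcs⇒initial D B F (ℕ.suc t) v source (inj₂ (_ , u , _ , _ , arc , _)) =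
  ⊥-elim (true≢false (trans (≡-sym arc) (source u)))

-- Stages can only grow when passing to a subdigraph D of E that keeps the
-- forces of F: each force of F keeps its arc and loses white out-neighbours.
stage-restrict : ∀ {n} (E D : Digraph n) B F → (∀ u v → D u v ≡ true → E u v ≡ true) →
  (∀ u w → (u , w) ∈ₗ F → D u w ≡ true) →
  ∀ t v → InStage E B F t v → InStage D B F t v
stage-restrict E D B F D⊆E forcesInD ℕ.zero v p = p
stage-restrict E D B F D⊆E forcesInD (ℕ.suc t) v (inj₁ p) =
  inj₁ (stage-restrict E D B F D⊆E forcesInD t v p)
stage-restrict E D B F D⊆E forcesInD (ℕ.suc t) w (inj₂ (_ , u , u→w , u∈ , _ , unique))
  with inStage? D B F t w
... | yes w∈ = inj₁ w∈
... | no w∉ = inj₂ (w∉ , u , u→w , earlier u u∈ , forcesInD u w u→w ,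
                    λ x arc x∉ → unique x (D⊆E u x arc) (λ x∈ → x∉ (earlier x x∈)))
  where
  earlier : ∀ v → InStage E B F t v → InStage D B F t v
  earlier = stage-restrict E D B F D⊆E forcesInD t

-- Every value achieved on G is achieved on some orientation of G: orient each
-- edge used by a force of the run in its forcing direction.
forcing-orientation : ∀ {n} (G : Graph n) {v : ℕ} → Achieves (asDigraph G) v →
  ∃[ D ] (Orientation G D × Achieves D v)
forcing-orientation {n} G (B , F , t , (L , L↭F , run) , allBlue , value) =
  oriented , isOrientation , B , F , t , (L , L↭F , restricted) , allBlueD , value
  where
  open Runs (asDigraph G)

  R : Fin n → Fin n → Bool
  R x y = does ((x , y) ∈ₗ? L)

  R-asym : ∀ x y → adj G x y ≡ true → R x y ≡ true → R y x ≡ false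
  R-asym x y _ with (x , y) ∈ₗ? L | (y , x) ∈ₗ? L
  ... | yes p | yes q = ⊥-elim (no-opposite-forces B L run p q)
  ... | yes _ | no _ = λ _ → refl
  ... | no _ | _ = λ ()

  open Preferred G R R-asym

  forcesInD : ∀ u w → (u , w) ∈ₗ L → oriented u w ≡ true
  forcesInD u w p = follows-preference u w (force-is-arc B L run p) (dec-true ((u , w) ∈ₗ? L) p)

  inL : ∀ {u w} → (u , w) ∈ₗ F → (u , w) ∈ₗ L
  inL = ∈-resp-↭ (↭-sym L↭F)

  covered : ∀ v → v ∈ₛ B ⊎ ∃[ u ] ((u , v) ∈ₗ L)
  covered v with stage-origin (asDigraph G) B F t v (allBlue v)
  ... | inj₁ v∈ = inj₁ v∈
  ... | inj₂ (u , u→v) = inj₂ (u , inL u→v)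

  restricted : ValidRun oriented B L
  restricted = restrict-run oriented arcs⊆edges B L forcesInD covered run

  allBlueD : AllBlueAt oriented B F t
  allBlueD v = stage-restrict (asDigraph G) oriented B F arcs⊆edges
    (λ u w p → forcesInD u w (inL p)) t v (allBlue v)

min≤th : ∀ {n} (G : Graph n) (m : ℕ) → IsMinOrientTh G m → ∀ t → ThIs (asDigraph G) t → m ≤ t
min≤th G m isMin t (achieved , _) with forcing-orientation G achieved
... | D , oriented , achievedD = min≤achieved G D isMin oriented achievedD

independent-misses : ∀ {n} (G : Graph n) → HasEdge G → (S : Subset n) → IsIndependent G S →
  ∃[ x ] x ∉ₛ S
independent-misses G (u , v , e) S independent with u ∈ₛ? S
... | no u∉ = u , u∉
... | yes u∈ = v , λ v∈ → true≢false (trans (≡-sym e) (independent u v u∈ v∈))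

source-orientation : ∀ {n} (G : Graph n) → HasEdge G → (S : Subset n) → IsIndependent G S →
  ∃[ D ] (Orientation G D × ∀ k → Achieves D k → ∣ S ∣ + 1 ≤ k)
source-orientation {n} G hasEdge S independent = oriented , isOrientation , bound
  where
  R : Fin n → Fin n → Bool
  R x y = does (x ∈ₛ? S)

  R-asym : ∀ x y → adj G x y ≡ true → R x y ≡ true → R y x ≡ false
  R-asym x y e with x ∈ₛ? S | y ∈ₛ? S
  ... | yes x∈ | yes y∈ = ⊥-elim (true≢false (trans (≡-sym e) (independent x y x∈ y∈)))
  ... | yes _ | no _ = λ _ → refl
  ... | no _ | _ = λ ()

  open Preferred G R R-asym

  source : ∀ v → v ∈ₛ S → ∀ u → oriented u v ≡ false
  source v v∈ u = against-preference u v (dec-true (v ∈ₛ? S) v∈)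

  bound : ∀ k → Achieves oriented k → ∣ S ∣ + 1 ≤ k
  bound _ (B , F , t , _ , allBlue , refl) = byTime t allBlue
    where
    S⊆B : ∀ {x} → x ∈ₛ S → x ∈ₛ B
    S⊆B {x} x∈ = no-in-arcs⇒initial oriented B F t x (source x x∈) (allBlue x)

    -- With no forcing round B = V strictly contains S; otherwise t ≥ 1.
    byTime : ∀ t → AllBlueAt oriented B F t → ∣ S ∣ + 1 ≤ ∣ B ∣ + t
    byTime ℕ.zero allInB with independent-misses G hasEdge S independent
    ... | x , x∉ = subst (_≤ ∣ B ∣ + 0) (+-comm 1 ∣ S ∣)
      (≤-trans (p⊂q⇒∣p∣<∣q∣ (S⊆B , x , allInB x , x∉)) (m≤m+n ∣ B ∣ 0))
    byTime (ℕ.suc t) _ = +-mono-≤ (p⊆q⇒∣p∣≤∣q∣ S⊆B) (s≤s z≤n)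

α+1≤max : ∀ {n} (G : Graph n) → HasEdge G → (M : ℕ) → IsMaxOrientTh G M →
  ∀ a → IndepNumber G a → a + 1 ≤ M
α+1≤max G hasEdge M isMax a ((S , independent , refl) , _)
  with source-orientation G hasEdge S independent
... | D , oriented , bound = bound≤max G D isMax oriented (allBlueWitness D) bound

proposition3p4 : ∀ {n} (G : Graph n) → HasEdge G →
    ∀ (m M : ℕ) → IsMinOrientTh G m → IsMaxOrientTh G M →
    (∀ t → ThIs (asDigraph G) t → m ≤ t) × (∀ a → IndepNumber G a → a + 1 ≤ M)
proposition3p4 G hasEdge m M isMin isMax = min≤th G m isMin , α+1≤max G hasEdge M isMax
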